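{- Let $m\in\mathbb Z$. If $m$ is not represented by $x^2+y^2+6z^2$, then $9m$ is not represented by $x^2+y^2+6z^2$.
   Context: An integer $n$ is represented by a form $Q(x,y,z)$ if there exist integers $x,y,z$ with $Q(x,y,z)=n$. -}

module Defs where

open import Data.Integer using (ℤ; _+_; _*_; +_)
open import Data.Product using (∃-syntax)
open import Relation.Binary.PropositionalEquality using (_≡_)

Q : ℤ → ℤ → ℤ → ℤ
Q x y z = x * x + y * y + + 6 * (z * z)

RepresentedByQ : ℤ → Set
RepresentedByQ n = ∃[ x ] ∃[ y ] ∃[ z ] Q x y z ≡ n

{-# OPTIONS --safe #-}
module Submission where

open import Defs
open import Data.Integer using (ℤ; _*_; +_; _+_; _-_)
open import Data.Integer.Properties using (+-comm; +-identityʳ; *-cancelˡ-≡)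
open import Data.Integer.DivMod using (_%_; _/_; a≡a%n+[a/n]*n; n%d<d)
open import Data.Integer.Divisibility.Signed using (_∣_; divides; _∣?_; ∣m+n∣m⇒∣n)
open import Data.Integer.Tactic.RingSolver using (solve-∀)
open import Data.Nat as ℕ using (s≤s)
open import Data.Product using (∃-syntax; _,_; _×_)
open import Relation.Nullary using (¬_; contradiction)
open import Relation.Nullary.Decidable using (from-no)
open import Relation.Binary.PropositionalEquality using (_≡_; refl; trans; sym; cong; subst; module ≡-Reasoning)

-- A square is 0 or 1 modulo 3, and it is 0 only for multiples of 3; so the
-- equation x² + y² + 6z² = 9m forces 3 ∣ x and 3 ∣ y (as −1 is not a square
-- mod 3), then 3 ∣ 2z², hence 3 ∣ z, and dividing by 9 represents m.

divMod3 : ∀ x → ∃[ q ] ∃[ r ] r ℕ.< 3 × x ≡ q * + 3 + + r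
divMod3 x = x / + 3 , x % + 3 , n%d<d x (+ 3) ,
  trans (a≡a%n+[a/n]*n x (+ 3)) (+-comm (+ (x % + 3)) ((x / + 3) * + 3))

3∣r²+s²⇒r≡0 : ∀ {r s} → r ℕ.< 3 → s ℕ.< 3 →
  + 3 ∣ + r * + r + + s * + s → r ≡ 0
3∣r²+s²⇒r≡0 {0}       _ _ _ = refl
3∣r²+s²⇒r≡0 {1} {0}   _ _ 3∣ = contradiction 3∣ (from-no (+ 3 ∣? + 1))
3∣r²+s²⇒r≡0 {1} {1}   _ _ 3∣ = contradiction 3∣ (from-no (+ 3 ∣? + 2))
3∣r²+s²⇒r≡0 {1} {2}   _ _ 3∣ = contradiction 3∣ (from-no (+ 3 ∣? + 5))
3∣r²+s²⇒r≡0 {2} {0}   _ _ 3∣ = contradiction 3∣ (from-no (+ 3 ∣? + 4))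
3∣r²+s²⇒r≡0 {2} {1}   _ _ 3∣ = contradiction 3∣ (from-no (+ 3 ∣? + 5))
3∣r²+s²⇒r≡0 {2} {2}   _ _ 3∣ = contradiction 3∣ (from-no (+ 3 ∣? + 8))
3∣r²+s²⇒r≡0 {ℕ.suc (ℕ.suc (ℕ.suc _))} (s≤s (s≤s (s≤s ()))) _ _
3∣r²+s²⇒r≡0 {1} {ℕ.suc (ℕ.suc (ℕ.suc _))} _ (s≤s (s≤s (s≤s ()))) _
3∣r²+s²⇒r≡0 {2} {ℕ.suc (ℕ.suc (ℕ.suc _))} _ (s≤s (s≤s (s≤s ()))) _

sum-of-squares-mod3 : ∀ q p r s →
  (q * + 3 + r) * (q * + 3 + r) + (p * + 3 + s) * (p * + 3 + s) ≡
  (q * (q * + 3 + r + r) + p * (p * + 3 + s + s)) * + 3 + (r * r + s * s)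
sum-of-squares-mod3 = solve-∀

3∣x²+y²⇒3∣x : ∀ x y → + 3 ∣ x * x + y * y → + 3 ∣ x
3∣x²+y²⇒3∣x x y 3∣x²+y² with divMod3 x | divMod3 y
... | q , r , r<3 , refl | p , s , s<3 , refl
  with 3∣r²+s²⇒r≡0 r<3 s<3 3∣r²+s²
  where
  k : ℤ
  k = q * (q * + 3 + + r + + r) + p * (p * + 3 + + s + + s)
  3∣r²+s² : + 3 ∣ + r * + r + + s * + s
  3∣r²+s² = ∣m+n∣m⇒∣n (subst (+ 3 ∣_) (sum-of-squares-mod3 q p (+ r) (+ s)) 3∣x²+y²)
                      (divides k refl)
... | refl = divides q (+-identityʳ (q * + 3))

Q-scale : ∀ k x y z → Q (x * k) (y * k) (z * k) ≡ k * k * Q x y z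
Q-scale = scale
  where
  scale : ∀ k x y z → (x * k) * (x * k) + (y * k) * (y * k) + + 6 * ((z * k) * (z * k))
                    ≡ k * k * (x * x + y * y + + 6 * (z * z))
  scale = solve-∀

Q-swap : ∀ x y z → Q x y z ≡ Q y x z
Q-swap x y z = cong (_+ + 6 * (z * z)) (+-comm (x * x) (y * y))

Q≡9m⇒3∣x : ∀ x y z {m} → Q x y z ≡ + 9 * m → + 3 ∣ x
Q≡9m⇒3∣x x y z {m} Qxyz≡9m = 3∣x²+y²⇒3∣x x y (divides (+ 3 * m - + 2 * (z * z)) (begin
  x * x + y * y                   ≡⟨ isolate (x * x + y * y) (+ 6 * (z * z)) ⟩
  Q x y z - + 6 * (z * z)         ≡⟨ cong (_- + 6 * (z * z)) Qxyz≡9m ⟩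
  + 9 * m - + 6 * (z * z)         ≡⟨ factor m (z * z) ⟩
  (+ 3 * m - + 2 * (z * z)) * + 3 ∎))
  where
  open ≡-Reasoning
  isolate : ∀ u v → u ≡ u + v - v
  isolate = solve-∀
  factor : ∀ u v → + 9 * u - + 6 * v ≡ (+ 3 * u - + 2 * v) * + 3
  factor = solve-∀

Q≡9m⇒3∣z : ∀ a b z {m} → Q (a * + 3) (b * + 3) z ≡ + 9 * m → + 3 ∣ z
Q≡9m⇒3∣z a b z {m} Q≡9m = 3∣x²+y²⇒3∣x z z (divides (m - a * a - b * b)
  (*-cancelˡ-≡ (+ 3) (z * z + z * z) ((m - a * a - b * b) * + 3) (begin
    + 3 * (z * z + z * z)                           ≡⟨ isolate a b z ⟩
    Q (a * + 3) (b * + 3) z - + 9 * (a * a + b * b) ≡⟨ cong (_- + 9 * (a * a + b * b)) Q≡9m ⟩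
    + 9 * m - + 9 * (a * a + b * b)                 ≡⟨ factor m a b ⟩
    + 3 * ((m - a * a - b * b) * + 3)               ∎)))
  where
  open ≡-Reasoning
  isolate : ∀ a b z → + 3 * (z * z + z * z) ≡
    (a * + 3) * (a * + 3) + (b * + 3) * (b * + 3) + + 6 * (z * z) - + 9 * (a * a + b * b)
  isolate = solve-∀
  factor : ∀ m a b → + 9 * m - + 9 * (a * a + b * b) ≡ + 3 * ((m - a * a - b * b) * + 3)
  factor = solve-∀

mainTheorem10 : (m : ℤ) → ¬ RepresentedByQ m → ¬ RepresentedByQ (+ 9 * m)
mainTheorem10 m m-unrepresented (x , y , z , Qxyz≡9m)
  with divides a refl ← Q≡9m⇒3∣x x y z Qxyz≡9m
     | divides b refl ← Q≡9m⇒3∣x y x z (trans (Q-swap y x z) Qxyz≡9m)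
  with divides c refl ← Q≡9m⇒3∣z a b z Qxyz≡9m
  = m-unrepresented (a , b , c , *-cancelˡ-≡ (+ 9) (Q a b c) m
      (trans (sym (Q-scale (+ 3) a b c)) Qxyz≡9m))
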